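{- Let $D_1$ and $D_2$ be two vertex disjoint digraphs with Hamiltonian cycles $C_1=(x_0,x_1,\ldots,x_{n-1},x_0)$ and $C_2=(y_0,y_1,\ldots,y_{m-1},y_0)$, respectively, and let $D\in D_1\oplus D_2$. If $D$ is strong and has no good pair (with respect to $C_1$ and $C_2$), then for each vertex $v\in V(D)$ and each integer $t$ with $3\le t\le 2m_1$, there is a directed cycle of length $t$ in $D$ passing through $v$, where $m_1=\min\{n,m\}$.
   Context: All paths and cycles are directed. Generalized sum: for pairwise vertex disjoint digraphs $D_1,\ldots,D_k$, $\oplus_{i=1}^k D_i$ is the set of all digraphs $D$ with $V(D)=\bigcup_i V(D_i)$, such that the subdigraph of $D$ induced by $V(D_i)$ is $D_i$ for each $i$, and such that between each pair of vertices lying in different $D_i$'s there is exactly one arc (in one direction). A digraph is strong if for any two distinct vertices $u,v$ there are a directed $uv$-path and a directed $vu$-path. Good pair: given two vertex disjoint cycles $C_1=(x_0,\ldots,x_{n-1},x_0)$ and $C_2=(y_0,\ldots,y_{m-1},y_0)$ in $D$, a good pair is a pair of arcs $x_s\to y_r$ and $y_{r-1}\to x_{s+1}$ of $D$ for some $s\in\{0,\ldots,n-1\}$, $r\in\{0,\ldots,m-1\}$ (subscripts modulo $n$ and $m$ respectively); $D$ "has no good pair" means no such pair of arcs exists between $C_1$ and $C_2$. -}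

module Defs where

open import Data.Nat using (ℕ; zero; suc; _+_; _*_; _≤_; _⊓_)
open import Data.Nat.DivMod using (_mod_)
open import Data.Fin using (Fin; toℕ; fromℕ; inject₁) renaming (zero to fzero; suc to fsuc)
open import Data.Sum using (_⊎_; inj₁; inj₂)
open import Data.Product using (Σ; _×_; ∃; ∃-syntax)
open import Function.Definitions using (Injective)
open import Relation.Binary.PropositionalEquality using (_≡_; _≢_)
open import Relation.Nullary using (¬_)

next : ∀ {n} → Fin n → Fin n
next {suc k} i = suc (toℕ i) mod suc k

prev : ∀ {n} → Fin n → Fin n
prev {suc k} i = (toℕ i + k) mod suc k

-- A digraph on vertex type V is given by its arc relation (no multiple arcs).
Arcs : Set → Set₁
Arcs V = V → V → Set

Loopless : ∀ {V} → Arcs V → Set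
Loopless A = ∀ v → ¬ A v v

Path : ∀ {V} → Arcs V → V → V → Set
Path {V} A u v =
  ∃[ k ] Σ (Fin (suc k) → V) λ p →
    Injective _≡_ _≡_ p × p fzero ≡ u × p (fromℕ k) ≡ v ×
    (∀ (i : Fin k) → A (p (inject₁ i)) (p (fsuc i)))

Strong : ∀ {V} → Arcs V → Set
Strong {V} A = ∀ (u v : V) → u ≢ v → Path A u v

IsCycle : ∀ {V} → Arcs V → (t : ℕ) → (Fin t → V) → Set
IsCycle A t c = 2 ≤ t × Injective _≡_ _≡_ c × (∀ i → A (c i) (c (next i)))

CycleThrough : ∀ {V} → Arcs V → ℕ → V → Set
CycleThrough {V} A t v = Σ (Fin t → V) λ c → IsCycle A t c × ∃[ i ] c i ≡ v

-- Hamiltonian cycle of a digraph on vertex set Fin n: an enumeration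
-- x_0, …, x_{n-1} of all vertices (injective, hence bijective) forming a cycle.
HamCycle : ∀ {n} → Arcs (Fin n) → (Fin n → Fin n) → Set
HamCycle {n} A x = IsCycle A n x

-- D has vertex set V(D1) ⊎ V(D2) = Fin n ⊎ Fin m.
-- Induced subdigraphs of D on the two parts:
D₁ : ∀ {n m} → Arcs (Fin n ⊎ Fin m) → Arcs (Fin n)
D₁ A a b = A (inj₁ a) (inj₁ b)

D₂ : ∀ {n m} → Arcs (Fin n ⊎ Fin m) → Arcs (Fin m)
D₂ A a b = A (inj₂ a) (inj₂ b)

-- D ∈ D1 ⊕ D2 : D1, D2 are the induced subdigraphs (by construction above) and
-- between any vertex of D1 and any vertex of D2 there is exactly one arc.
GenSum : ∀ {n m} → Arcs (Fin n ⊎ Fin m) → Set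
GenSum {n} {m} A = ∀ (a : Fin n) (b : Fin m) →
  (A (inj₁ a) (inj₂ b) × ¬ A (inj₂ b) (inj₁ a)) ⊎
  (A (inj₂ b) (inj₁ a) × ¬ A (inj₁ a) (inj₂ b))

GoodPair : ∀ {n m} → Arcs (Fin n ⊎ Fin m) → (Fin n → Fin n) → (Fin m → Fin m) → Set
GoodPair {n} {m} A x y = ∃[ s ] ∃[ r ]
  (A (inj₁ (x s)) (inj₂ (y r)) × A (inj₂ (y (prev r))) (inj₁ (x (next s))))

-- Index C₁ and C₂ by ℕ, writing X k = x_{k mod n} and Y l = y_{l mod m}.  Without a good pair
-- an arc X k → Y l forces the arc X (k + 1) → Y (l − 1); going around both cycles, the direction
-- of the arc between X k and Y l therefore depends only on k + l modulo m.  Strong connectivity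
-- makes both directions occur, so some j has X 0 → Y j but Y (j + 1) → X 0.  Running along C₁,
-- crossing to C₂, running along C₂ and crossing back gives a cycle whose two crossing arcs are
-- governed by two values of the sum; the sums j and j + 1 yield every odd length.  For an even
-- length, look at the run of backward sums j + 1, j + 2, … : if it is short, a second excursion
-- to C₂ fits in; if it is long, the sums j and j + 2 give the cycle directly.  Since only
-- s + r modulo m matters, the cycle can be moved through any vertex.

module Submission where

open import Defs
open import Data.Nat using (ℕ; zero; suc; _+_; _*_; _≤_; _<_; _⊓_; z≤n; s≤s; NonZero; _≤?_)
open import Data.Nat.Properties
open import Data.Nat.DivMod
  using (_%_; _mod_; m%n<n; m<n⇒m%n≡m; n%n≡0; [m+n]%n≡m%n; [m+kn]%n≡m%n; %-distribˡ-+; m%n%n≡m%n)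
open import Data.Nat.Tactic.RingSolver using (solve)
open import Data.List using (_∷_; [])
open import Data.Fin using (Fin; toℕ; fromℕ; fromℕ<; inject₁; punchOut)
  renaming (zero to fzero; suc to fsuc)
import Data.Fin.Properties as Fin
open import Data.Sum using (_⊎_; inj₁; inj₂)
open import Data.Sum.Properties using (inj₁-injective; inj₂-injective)
open import Data.Product using (_×_; _,_; proj₁; proj₂; ∃; ∃-syntax; ∃₂)
open import Data.Empty using (⊥; ⊥-elim)
open import Data.Unit using (⊤; tt)
open import Function using (_∘_; _$_; id)
open import Function.Definitions using (Injective)
open import Relation.Nullary using (¬_; ¬?; Dec; yes; no; contradiction)
open import Relation.Nullary.Decidable using (decidable-stable)
open import Relation.Binary.PropositionalEquality

module _ {d : ℕ} .{{_ : NonZero d}} where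

  +-congʳ-mod : ∀ a b k → a % d ≡ b % d → (a + k) % d ≡ (b + k) % d
  +-congʳ-mod a b k a≡b = begin
    (a + k) % d              ≡⟨ %-distribˡ-+ a k d ⟩
    (a % d + k % d) % d      ≡⟨ cong (λ z → (z + k % d) % d) a≡b ⟩
    (b % d + k % d) % d      ≡⟨ %-distribˡ-+ b k d ⟨
    (b + k) % d              ∎
    where open ≡-Reasoning

  +-congˡ-mod : ∀ a b k → a % d ≡ b % d → (k + a) % d ≡ (k + b) % d
  +-congˡ-mod a b k a≡b =
    subst₂ (λ u v → u % d ≡ v % d) (+-comm a k) (+-comm b k) (+-congʳ-mod a b k a≡b)

  toℕ-mod : ∀ a → toℕ (a mod d) ≡ a % d
  toℕ-mod a = Fin.toℕ-fromℕ< (m%n<n a d)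

  mod-cong : ∀ a b → a % d ≡ b % d → a mod d ≡ b mod d
  mod-cong a b a≡b = Fin.toℕ-injective (trans (toℕ-mod a) (trans a≡b (sym (toℕ-mod b))))

  mod-toℕ : ∀ (i : Fin d) → toℕ i mod d ≡ i
  mod-toℕ i = Fin.toℕ-injective (trans (toℕ-mod (toℕ i)) (m<n⇒m%n≡m (Fin.toℕ<n i)))

module _ {d : ℕ} where

  +-cancelʳ-mod : ∀ a b c → (a + c) % suc d ≡ (b + c) % suc d → a % suc d ≡ b % suc d
  +-cancelʳ-mod a b c e = begin
    a % suc d                  ≡⟨ [m+kn]%n≡m%n a c (suc d) ⟨
    (a + c * suc d) % suc d    ≡⟨ cong (_% suc d) (absorb a) ⟩
    (a + c + c * d) % suc d    ≡⟨ +-congʳ-mod (a + c) (b + c) (c * d) e ⟩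
    (b + c + c * d) % suc d    ≡⟨ cong (_% suc d) (absorb b) ⟨
    (b + c * suc d) % suc d    ≡⟨ [m+kn]%n≡m%n b c (suc d) ⟩
    b % suc d                  ∎
    where
      open ≡-Reasoning
      absorb : ∀ x → x + c * suc d ≡ x + c + c * d
      absorb x = solve (x ∷ c ∷ d ∷ [])

  +-cancelʳ-window : ∀ i j s → i < suc d → j < suc d →
                     (i + s) % suc d ≡ (j + s) % suc d → i ≡ j
  +-cancelʳ-window i j s i<d j<d e =
    trans (sym (m<n⇒m%n≡m i<d)) (trans (+-cancelʳ-mod i j s e) (m<n⇒m%n≡m j<d))

  private
    toℕ-mod-mod : ∀ k → toℕ (k mod suc d) % suc d ≡ k % suc d
    toℕ-mod-mod k = trans (cong (_% suc d) (toℕ-mod k)) (m%n%n≡m%n k (suc d))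

  next-mod : ∀ k → next (k mod suc d) ≡ suc k mod suc d
  next-mod k = mod-cong (suc (toℕ (k mod suc d))) (suc k)
    (+-congˡ-mod (toℕ (k mod suc d)) k 1 (toℕ-mod-mod k))

  prev-mod : ∀ l → prev (l mod suc d) ≡ (l + d) mod suc d
  prev-mod l = mod-cong (toℕ (l mod suc d) + d) (l + d)
    (+-congʳ-mod (toℕ (l mod suc d)) l d (toℕ-mod-mod l))

first-exit : ∀ (P : ℕ → Set) → (∀ i → Dec (P i)) → ∀ L → P 0 → ¬ P L →
  ∃[ i ] i < L × (∀ i′ → i′ ≤ i → P i′) × ¬ P (suc i)
first-exit P P? zero p0 ¬pL = contradiction p0 ¬pL
first-exit P P? (suc L) p0 ¬pL with P? 1
... | no ¬p1 = 0 , s≤s z≤n , (λ { zero _ → p0 }) , ¬p1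
... | yes p1 with first-exit (P ∘ suc) (P? ∘ suc) L p1 ¬pL
...   | i , i<L , stay , exit = suc i , s≤s i<L , stay′ , exit
  where
    stay′ : ∀ i′ → i′ ≤ suc i → P i′
    stay′ zero _ = p0
    stay′ (suc i′) (s≤s i′≤i) = stay i′ i′≤i

injective⇒surjective : ∀ {n} (f : Fin n → Fin n) → Injective _≡_ _≡_ f →
                       ∀ w → ∃[ i ] f i ≡ w
injective⇒surjective {suc n} f f-inj w with Fin.any? (λ i → f i Fin.≟ w)
... | yes hit = hit
... | no miss = ⊥-elim (Fin.<⇒notInjective (n<1+n n) punched-inj)
  where
    missed : ∀ i → w ≢ f i
    missed i w≡fi = miss (i , sym w≡fi)
    punched : Fin (suc n) → Fin n
    punched i = punchOut (missed i)
    punched-inj : Injective _≡_ _≡_ punched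
    punched-inj {i} {j} = f-inj ∘ Fin.punchOut-injective (missed i) (missed j)

module _ {V : Set} {A : Arcs V} (P : V → Set) (P? : ∀ v → Dec (P v)) where

  path-leaves : ∀ {u w} → Path A u w → P u → ¬ P w → ∃₂ λ a b → A a b × P a × ¬ P b
  path-leaves (k , p , _ , refl , refl , arcs) = go k p arcs
    where
      go : ∀ k (p : Fin (suc k) → V) → (∀ i → A (p (inject₁ i)) (p (fsuc i))) →
           P (p fzero) → ¬ P (p (fromℕ k)) → ∃₂ λ a b → A a b × P a × ¬ P b
      go zero p _ start end = contradiction start end
      go (suc k) p arcs start end with P? (p (fsuc fzero))
      ... | no out = p fzero , p (fsuc fzero) , arcs fzero , start , out
      ... | yes stays = go k (p ∘ fsuc) (arcs ∘ fsuc) stays end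

data Split (c : ℕ) : ℕ → Set where
  before : ∀ {i} → i < c → Split c i
  after  : ∀ k → Split c (c + k)

split : ∀ c i → Split c i
split zero i = after i
split (suc c) zero = before (s≤s z≤n)
split (suc c) (suc i) with split c i
... | before i<c = before (s≤s i<c)
... | after k = after k

splice : ∀ {V : Set} → ℕ → (ℕ → V) → (ℕ → V) → ℕ → V
splice zero f g i = g i
splice (suc c) f g zero = f zero
splice (suc c) f g (suc i) = splice c (f ∘ suc) g i

splice-< : ∀ {V : Set} {f g : ℕ → V} {c i} → i < c → splice c f g i ≡ f i
splice-< {c = suc c} {zero} _ = refl
splice-< {f = f} {c = suc c} {suc i} (s≤s i<c) = splice-< {f = f ∘ suc} i<c

splice-+ : ∀ {V : Set} {f g : ℕ → V} c k → splice c f g (c + k) ≡ g k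
splice-+ zero k = refl
splice-+ {f = f} (suc c) k = splice-+ {f = f ∘ suc} c k

module _ {V : Set} (A : Arcs V) where

  record SimplePath (len : ℕ) : Set where
    field
      vertex   : ℕ → V
      distinct : ∀ {i j} → i < len → j < len → vertex i ≡ vertex j → i ≡ j
      linked   : ∀ {i} → suc i < len → A (vertex i) (vertex (suc i))

  open SimplePath public

  Disjoint : ∀ {a b} → SimplePath a → SimplePath b → Set
  Disjoint {a} {b} P Q = ∀ {i j} → i < a → j < b → vertex P i ≢ vertex Q j

  append : ∀ {a b} (P : SimplePath (suc a)) (Q : SimplePath b) →
           Disjoint P Q → A (vertex P a) (vertex Q 0) → SimplePath (suc a + b)
  append {a} {b} P Q P∩Q≡∅ bridge = record
    { vertex = walk ; distinct = distinct′ ; linked = linked′ }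
    where
      walk : ℕ → V
      walk = splice (suc a) (vertex P) (vertex Q)

      in-P : ∀ {i} → i < suc a → walk i ≡ vertex P i
      in-P = splice-< {f = vertex P}

      in-Q : ∀ k → walk (suc a + k) ≡ vertex Q k
      in-Q = splice-+ {f = vertex P} (suc a)

      distinct′ : ∀ {i j} → i < suc a + b → j < suc a + b → walk i ≡ walk j → i ≡ j
      distinct′ {i} {j} i<ab j<ab with split (suc a) i | split (suc a) j
      ... | before i<a | before j<a = λ e →
        distinct P i<a j<a (trans (sym (in-P i<a)) (trans e (in-P j<a)))
      ... | before i<a | after l = λ e →
        ⊥-elim (P∩Q≡∅ i<a (+-cancelˡ-< (suc a) l b j<ab) (trans (sym (in-P i<a)) (trans e (in-Q l))))
      ... | after k | before j<a = λ e →
        ⊥-elim (P∩Q≡∅ j<a (+-cancelˡ-< (suc a) k b i<ab) (trans (sym (in-P j<a)) (trans (sym e) (in-Q k))))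
      ... | after k | after l = λ e → cong (suc a +_)
        (distinct Q (+-cancelˡ-< (suc a) k b i<ab) (+-cancelˡ-< (suc a) l b j<ab)
          (trans (sym (in-Q k)) (trans e (in-Q l))))

      linked′ : ∀ {i} → suc i < suc a + b → A (walk i) (walk (suc i))
      linked′ {i} si<ab with split (suc a) i
      ... | after k = subst₂ A (sym (in-Q k)) (sym (trans (cong walk (sym (+-suc (suc a) k))) (in-Q (suc k))))
        (linked Q (+-cancelˡ-< (suc a) (suc k) b (subst (_< suc a + b) (sym (+-suc (suc a) k)) si<ab)))
      ... | before (s≤s i≤a) with m≤n⇒m<n∨m≡n i≤a
      ...   | inj₁ i<a = subst₂ A (sym (in-P (s≤s (<⇒≤ i<a)))) (sym (in-P (s≤s i<a))) (linked P (s≤s i<a))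
      ...   | inj₂ refl = subst₂ A (sym (in-P ≤-refl))
        (sym (trans (cong walk (sym (+-identityʳ (suc a)))) (in-Q 0))) bridge

  append-right : ∀ {a b} (P : SimplePath (suc a)) (Q : SimplePath b)
                 (P∩Q≡∅ : Disjoint P Q) (bridge : A (vertex P a) (vertex Q 0)) k →
                 vertex (append P Q P∩Q≡∅ bridge) (suc a + k) ≡ vertex Q k
  append-right {a} P Q _ _ = splice-+ {f = vertex P} (suc a)

  disjoint-append : ∀ {c a b} (R : SimplePath c) (P : SimplePath (suc a)) (Q : SimplePath b)
                    (P∩Q≡∅ : Disjoint P Q) (bridge : A (vertex P a) (vertex Q 0)) →
                    Disjoint R P → Disjoint R Q → Disjoint R (append P Q P∩Q≡∅ bridge)
  disjoint-append {a = a} {b} R P Q P∩Q≡∅ bridge R∩P≡∅ R∩Q≡∅ {i} {j} i<c j<ab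
    with split (suc a) j
  ... | before j<a = λ e → R∩P≡∅ i<c j<a (trans e (splice-< {f = vertex P} j<a))
  ... | after l = λ e →
    R∩Q≡∅ i<c (+-cancelˡ-< (suc a) l b j<ab) (trans e (append-right P Q P∩Q≡∅ bridge l))

  cycle-through : ∀ {t} (C : SimplePath (suc t)) → 1 ≤ t → A (vertex C t) (vertex C 0) →
                  ∀ {i} → i < suc t → CycleThrough A (suc t) (vertex C i)
  cycle-through {t} C 1≤t closing i<t =
    (vertex C ∘ toℕ) , (s≤s 1≤t , distinct′ , arcs) , fromℕ< i<t , cong (vertex C) (Fin.toℕ-fromℕ< i<t)
    where
      distinct′ : Injective _≡_ _≡_ (vertex C ∘ toℕ)
      distinct′ {i} {j} = Fin.toℕ-injective ∘ distinct C (Fin.toℕ<n i) (Fin.toℕ<n j)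

      arcs : ∀ i → A (vertex C (toℕ i)) (vertex C (toℕ (next i)))
      arcs i with m≤n⇒m<n∨m≡n (≤-pred (Fin.toℕ<n i))
      ... | inj₁ i<t = subst (λ k → A (vertex C (toℕ i)) (vertex C k))
        (sym (trans (toℕ-mod (suc (toℕ i))) (m<n⇒m%n≡m (s≤s i<t)))) (linked C (s≤s i<t))
      ... | inj₂ i≡t = subst₂ (λ k l → A (vertex C k) (vertex C l)) (sym i≡t)
        (sym (trans (toℕ-mod (suc (toℕ i))) (trans (cong (λ k → suc k % suc t) i≡t) (n%n≡0 (suc t)))))
        closing

even-or-odd : ∀ t → ∃[ k ] (t ≡ k + k ⊎ t ≡ suc (k + k))
even-or-odd zero = 0 , inj₁ refl
even-or-odd (suc t) with even-or-odd t
... | k , inj₁ refl = k , inj₂ refl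
... | k , inj₂ refl = suc k , inj₁ (cong suc (sym (+-suc k k)))

half-≤ : ∀ k M → k + k ≤ 2 * M → k ≤ M
half-≤ k M 2k≤2M = ≮⇒≥ λ M<k →
  <⇒≱ (+-mono-< M<k M<k) (subst (k + k ≤_) (cong (M +_) (+-identityʳ M)) 2k≤2M)

half-< : ∀ k M → suc (k + k) ≤ 2 * M → k < M
half-< k M 2k<2M = ≰⇒> λ M≤k →
  <⇒≱ (subst (k + k <_) (cong (M +_) (+-identityʳ M)) 2k<2M) (+-mono-≤ M≤k M≤k)

module WithoutGoodPair
  (n′ m′ : ℕ) (A : Arcs (Fin (suc n′) ⊎ Fin (suc m′)))
  (x : Fin (suc n′) → Fin (suc n′)) (y : Fin (suc m′) → Fin (suc m′))
  (one-arc : GenSum A) (x-cycle : HamCycle (D₁ A) x) (y-cycle : HamCycle (D₂ A) y)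
  (no-good-pair : ¬ GoodPair A x y)
  where

  n m : ℕ
  n = suc n′
  m = suc m′

  V : Set
  V = Fin n ⊎ Fin m

  X Y : ℕ → V
  X k = inj₁ (x (k mod n))
  Y l = inj₂ (y (l mod m))

  X-step : ∀ k → A (X k) (X (suc k))
  X-step k = subst (λ i → A (X k) (inj₁ (x i))) (next-mod k) (proj₂ (proj₂ x-cycle) (k mod n))

  Y-step : ∀ l → A (Y l) (Y (suc l))
  Y-step l = subst (λ i → A (Y l) (inj₂ (y i))) (next-mod l) (proj₂ (proj₂ y-cycle) (l mod m))

  X-distinct : ∀ s {i j} → i < n → j < n → X (i + s) ≡ X (j + s) → i ≡ j
  X-distinct s {i} {j} i<n j<n e = +-cancelʳ-window i j s i<n j<n
    (trans (sym (toℕ-mod (i + s)))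
      (trans (cong toℕ (proj₁ (proj₂ x-cycle) (inj₁-injective e))) (toℕ-mod (j + s))))

  Y-distinct : ∀ r {i j} → i < m → j < m → Y (i + r) ≡ Y (j + r) → i ≡ j
  Y-distinct r {i} {j} i<m j<m e = +-cancelʳ-window i j r i<m j<m
    (trans (sym (toℕ-mod (i + r)))
      (trans (cong toℕ (proj₁ (proj₂ y-cycle) (inj₂-injective e))) (toℕ-mod (j + r))))

  X-onto : ∀ a → ∃[ k ] X k ≡ inj₁ a
  X-onto a with injective⇒surjective x (proj₁ (proj₂ x-cycle)) a
  ... | σ , xσ≡a = toℕ σ , cong inj₁ (trans (cong x (mod-toℕ σ)) xσ≡a)

  Y-onto : ∀ b → ∃[ l ] Y l ≡ inj₂ b
  Y-onto b with injective⇒surjective y (proj₁ (proj₂ y-cycle)) b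
  ... | ρ , yρ≡b = toℕ ρ , cong inj₂ (trans (cong y (mod-toℕ ρ)) yρ≡b)

  F : ℕ → ℕ → Set
  F k l = A (X k) (Y l)

  F-resp : ∀ k k′ l l′ → k % n ≡ k′ % n → l % m ≡ l′ % m → F k l → F k′ l′
  F-resp k k′ l l′ k≡k′ l≡l′ =
    subst₂ (λ i j → A (inj₁ (x i)) (inj₂ (y j))) (mod-cong k k′ k≡k′) (mod-cong l l′ l≡l′)

  F? : ∀ k l → Dec (F k l)
  F? k l with one-arc (x (k mod n)) (y (l mod m))
  ... | inj₁ (fwd , _) = yes fwd
  ... | inj₂ (_ , ¬fwd) = no ¬fwd

  ¬F⇒backward : ∀ k l → ¬ F k l → A (Y l) (X k)
  ¬F⇒backward k l ¬f with one-arc (x (k mod n)) (y (l mod m))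
  ... | inj₁ (fwd , _) = contradiction fwd ¬f
  ... | inj₂ (bwd , _) = bwd

  backward⇒¬F : ∀ k l → A (Y l) (X k) → ¬ F k l
  backward⇒¬F k l bwd with one-arc (x (k mod n)) (y (l mod m))
  ... | inj₁ (_ , ¬bwd) = contradiction bwd ¬bwd
  ... | inj₂ (_ , ¬fwd) = ¬fwd

  F-shift : ∀ {k l} → F k l → F (suc k) (l + m′)
  F-shift {k} {l} f with one-arc (x (next (k mod n))) (y (prev (l mod m)))
  ... | inj₁ (fwd , _) = subst₂ (λ i j → A (inj₁ (x i)) (inj₂ (y j))) (next-mod k) (prev-mod l) fwd
  ... | inj₂ (bwd , _) = contradiction (k mod n , l mod m , f , bwd) no-good-pair

  F-shift* : ∀ i {k l} → F k l → F (i + k) (i * m′ + l)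
  F-shift* zero f = f
  F-shift* (suc i) {k} {l} f = subst (F (suc i + k)) regroup (F-shift {i + k} {i * m′ + l} (F-shift* i f))
    where
      regroup : i * m′ + l + m′ ≡ suc i * m′ + l
      regroup = solve (i ∷ l ∷ m′ ∷ [])

  Forward : ℕ → Set
  Forward j = F 0 j

  Forward⇒F : ∀ k l → Forward (k + l) → F k l
  Forward⇒F k l g =
    F-resp (k + 0) k (k * m′ + (k + l)) l (cong (_% n) (+-identityʳ k)) l-mod (F-shift* k g)
    where
      open ≡-Reasoning
      regroup : k * m′ + (k + l) ≡ l + k * suc m′
      regroup = solve (k ∷ l ∷ m′ ∷ [])
      l-mod : (k * m′ + (k + l)) % m ≡ l % m
      l-mod = begin
        (k * m′ + (k + l)) % m  ≡⟨ cong (_% m) regroup ⟩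
        (l + k * m) % m         ≡⟨ [m+kn]%n≡m%n l k m ⟩
        l % m                   ∎

  -- k (n m - 1) forward shifts bring x_k to x_0 and y_l to y_{k + l}
  F⇒Forward : ∀ k l → F k l → Forward (k + l)
  F⇒Forward k l f = F-resp (Q + k) 0 (Q * m′ + l) (k + l) k-mod l-mod (F-shift* Q f)
    where
      open ≡-Reasoning
      Q : ℕ
      Q = k * (n′ * suc m′ + m′)
      Q+k : k * (n′ * suc m′ + m′) + k ≡ 0 + k * suc m′ * suc n′
      Q+k = solve (k ∷ n′ ∷ m′ ∷ [])
      lhs : ∀ q → q * m′ + l + q ≡ l + q * suc m′
      lhs q = solve (q ∷ l ∷ m′ ∷ [])
      rhs : k + l + k * (n′ * suc m′ + m′) ≡ l + k * suc n′ * suc m′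
      rhs = solve (k ∷ l ∷ n′ ∷ m′ ∷ [])
      k-mod : (Q + k) % n ≡ 0
      k-mod = begin
        (Q + k) % n          ≡⟨ cong (_% n) Q+k ⟩
        (0 + k * m * n) % n  ≡⟨ [m+kn]%n≡m%n 0 (k * m) n ⟩
        0                    ∎
      l-mod : (Q * m′ + l) % m ≡ (k + l) % m
      l-mod = +-cancelʳ-mod (Q * m′ + l) (k + l) Q (begin
        (Q * m′ + l + Q) % m  ≡⟨ cong (_% m) (lhs Q) ⟩
        (l + Q * m) % m       ≡⟨ [m+kn]%n≡m%n l Q m ⟩
        l % m                 ≡⟨ [m+kn]%n≡m%n l (k * n) m ⟨
        (l + k * n * m) % m   ≡⟨ cong (_% m) rhs ⟨
        (k + l + Q) % m       ∎)

  Forward? : ∀ j → Dec (Forward j)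
  Forward? = F? 0

  Forward-resp : ∀ i j → i % m ≡ j % m → Forward i → Forward j
  Forward-resp i j = F-resp 0 0 i j refl

  backward-arc : ∀ k l → ¬ Forward (k + l) → A (Y l) (X k)
  backward-arc k l ¬g = ¬F⇒backward k l (¬g ∘ F⇒Forward k l)

  InD₁ : V → Set
  InD₁ (inj₁ _) = ⊤
  InD₁ (inj₂ _) = ⊥

  InD₁? : ∀ v → Dec (InD₁ v)
  InD₁? (inj₁ _) = yes tt
  InD₁? (inj₂ _) = no id

  some-forward : Strong A → ∃[ j ] Forward j
  some-forward strong with path-leaves {A = A} InD₁ InD₁? (strong (X 0) (Y 0) (λ ())) tt id
  ... | inj₁ a , inj₂ b , arc , _ , _ with X-onto a | Y-onto b
  ...   | k , refl | l , refl = k + l , F⇒Forward k l arc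
  some-forward strong | inj₁ _ , inj₁ _ , _ , _ , out = contradiction tt out

  some-backward : Strong A → ∃[ j ] ¬ Forward j
  some-backward strong
    with path-leaves {A = A} (¬_ ∘ InD₁) (¬? ∘ InD₁?) (strong (Y 0) (X 0) (λ ())) id (_$ tt)
  ... | inj₂ b , inj₁ a , arc , _ , _ with X-onto a | Y-onto b
  ...   | k , refl | l , refl = k + l , backward⇒¬F k l arc ∘ Forward⇒F k l
  some-backward strong | inj₂ _ , inj₂ _ , _ , _ , out = contradiction id out
  some-backward strong | inj₁ _ , _ , _ , out , _ = contradiction tt out

  switch : Strong A → ∃[ j ] Forward j × ¬ Forward (suc j)
  switch strong with some-forward strong | some-backward strong
  ... | i , g | j , ¬g with first-exit (Forward ∘ (i +_)) (Forward? ∘ (i +_)) (i * m′ + j) start end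
    where
      start : Forward (i + 0)
      start = subst Forward (sym (+-identityʳ i)) g
      wrap : i + (i * m′ + j) ≡ j + i * suc m′
      wrap = solve (i ∷ j ∷ m′ ∷ [])
      end : ¬ Forward (i + (i * m′ + j))
      end = ¬g ∘ Forward-resp (i + (i * m′ + j)) j (trans (cong (_% m) wrap) ([m+kn]%n≡m%n j i m))
  ... | k , _ , stay , exit = i + k , stay k ≤-refl , exit ∘ subst Forward (sym (+-suc i k))

  Through : ℕ → ℕ → ℕ → Set
  Through t s r = CycleThrough A t (X s) × CycleThrough A t (Y r)

  through-everywhere : ∀ t e j → (∀ s r → (e + s + r) % m ≡ j % m → Through t s r) →
                       ∀ v → CycleThrough A t v
  through-everywhere t e j through (inj₁ a) with X-onto a
  ... | k , refl = proj₁ (through k r (trans (cong (_% m) wrap) ([m+kn]%n≡m%n j (e + k) m)))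
    where
      r : ℕ
      r = j + (e + k) * m′
      wrap : e + k + (j + (e + k) * m′) ≡ j + (e + k) * suc m′
      wrap = solve (e ∷ j ∷ k ∷ m′ ∷ [])
  through-everywhere t e j through (inj₂ b) with Y-onto b
  ... | l , refl = proj₂ (through s l (trans (cong (_% m) wrap) ([m+kn]%n≡m%n j (e + l) m)))
    where
      s : ℕ
      s = j + (e + l) * m′
      wrap : e + (j + (e + l) * m′) + l ≡ j + (e + l) * suc m′
      wrap = solve (e ∷ j ∷ l ∷ m′ ∷ [])

  X-path : ∀ s {a} → a ≤ n → SimplePath A a
  X-path s a≤n = record
    { vertex   = λ i → X (i + s)
    ; distinct = λ i<a j<a → X-distinct s (≤-trans i<a a≤n) (≤-trans j<a a≤n)
    ; linked   = λ {i} _ → X-step (i + s)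
    }

  Y-path : ∀ r {b} → b ≤ m → SimplePath A b
  Y-path r b≤m = record
    { vertex   = λ i → Y (i + r)
    ; distinct = λ i<b j<b → Y-distinct r (≤-trans i<b b≤m) (≤-trans j<b b≤m)
    ; linked   = λ {i} _ → Y-step (i + r)
    }

  X-Y-disjoint : ∀ s r {a b} (a≤n : a ≤ n) (b≤m : b ≤ m) →
                 Disjoint A (X-path s a≤n) (Y-path r b≤m)
  X-Y-disjoint _ _ _ _ _ _ ()

  Y-X-disjoint : ∀ r s {a b} (b≤m : b ≤ m) (a≤n : a ≤ n) →
                 Disjoint A (Y-path r b≤m) (X-path s a≤n)
  Y-X-disjoint _ _ _ _ _ _ ()

  X-windows-disjoint : ∀ s {a b} (a≤n : a ≤ n) (b≤n : b ≤ n) → a + b ≤ n →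
                       Disjoint A (X-path s a≤n) (X-path (a + s) b≤n)
  X-windows-disjoint s {a} {b} _ _ ab≤n {i} {j} i<a j<b e =
    <⇒≢ (≤-trans i<a (m≤n+m a j)) (X-distinct s i<n ja<n (trans e (cong X (sym (+-assoc j a s)))))
    where
      i<n : i < n
      i<n = ≤-trans i<a (≤-trans (m≤m+n a b) ab≤n)
      ja<n : j + a < n
      ja<n = ≤-trans (+-monoˡ-< a j<b) (subst (_≤ n) (+-comm a b) ab≤n)

  Y-windows-disjoint : ∀ r {a b} (a≤m : a ≤ m) (b≤m : b ≤ m) → a + b ≤ m →
                       Disjoint A (Y-path r a≤m) (Y-path (a + r) b≤m)
  Y-windows-disjoint r {a} {b} _ _ ab≤m {i} {j} i<a j<b e =
    <⇒≢ (≤-trans i<a (m≤n+m a j)) (Y-distinct r i<m ja<m (trans e (cong Y (sym (+-assoc j a r)))))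
    where
      i<m : i < m
      i<m = ≤-trans i<a (≤-trans (m≤m+n a b) ab≤m)
      ja<m : j + a < m
      ja<m = ≤-trans (+-monoˡ-< a j<b) (subst (_≤ m) (+-comm a b) ab≤m)

  -- x_s … x_{a+s}, y_r … y_{d+a+r}
  two-block : ∀ a d s r → suc a ≤ n → suc (d + a) ≤ m →
              Forward (a + s + r) → ¬ Forward (d + (a + s + r)) → Through (suc a + suc (d + a)) s r
  two-block a d s r a<n da<m g ¬g =
    cycle-through A C 1≤t closing (s≤s z≤n) ,
    subst (CycleThrough A _) (append-right A Xs Ys Xs∩Ys≡∅ bridge 0)
      (cycle-through A C 1≤t closing (+-monoʳ-< (suc a) (s≤s z≤n)))
    where
      Xs : SimplePath A (suc a)
      Xs = X-path s a<n
      Ys : SimplePath A (suc (d + a))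
      Ys = Y-path r da<m
      Xs∩Ys≡∅ : Disjoint A Xs Ys
      Xs∩Ys≡∅ = X-Y-disjoint s r a<n da<m
      bridge : A (X (a + s)) (Y r)
      bridge = Forward⇒F (a + s) r g
      C : SimplePath A (suc a + suc (d + a))
      C = append A Xs Ys Xs∩Ys≡∅ bridge
      1≤t : 1 ≤ a + suc (d + a)
      1≤t = ≤-trans (s≤s z≤n) (m≤n+m (suc (d + a)) a)
      last : vertex C (a + suc (d + a)) ≡ Y (d + a + r)
      last = trans (cong (vertex C) (+-suc a (d + a))) (append-right A Xs Ys Xs∩Ys≡∅ bridge (d + a))
      regroup : d + (a + s + r) ≡ s + (d + a + r)
      regroup = solve (a ∷ d ∷ s ∷ r ∷ [])
      closing : A (vertex C (a + suc (d + a))) (X s)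
      closing = subst (λ v → A v (X s)) (sym last)
        (backward-arc s (d + a + r) (¬g ∘ subst Forward (sym regroup)))

  -- x_s … x_{a+s}, y_r, x_{1+a+s} … x_{1+a+b+s}, y_{1+r} … y_{1+a+b+r}
  four-block : ∀ a b s r → suc a + suc b ≤ n → suc (suc (a + b)) ≤ m →
               Forward (a + s + r) → ¬ Forward (suc (a + s + r)) →
               Forward (suc (suc b) + (a + s + r)) → ¬ Forward (suc b + (a + s + r)) →
               Through (suc a + (1 + (suc b + suc (a + b)))) s r
  four-block a b s r ab<n ab<m g₁ ¬g₂ g₃ ¬g₄ =
    cycle-through A C 1≤t closing (s≤s z≤n) ,
    subst (CycleThrough A _) (append-right A Xs₁ Rest Xs₁∩Rest≡∅ bridge₁ 0)
      (cycle-through A C 1≤t closing (+-monoʳ-< (suc a) (s≤s z≤n)))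
    where
      a<n : suc a ≤ n
      a<n = ≤-trans (m≤m+n (suc a) (suc b)) ab<n
      b<n : suc b ≤ n
      b<n = ≤-trans (m≤n+m (suc b) (suc a)) ab<n
      1<m : 1 ≤ m
      1<m = s≤s z≤n
      ab≤m : suc (a + b) ≤ m
      ab≤m = ≤-trans (n≤1+n _) ab<m

      Xs₁ : SimplePath A (suc a)
      Xs₁ = X-path s a<n
      Xs₂ : SimplePath A (suc b)
      Xs₂ = X-path (suc a + s) b<n
      Ys₁ : SimplePath A 1
      Ys₁ = Y-path r 1<m
      Ys₂ : SimplePath A (suc (a + b))
      Ys₂ = Y-path (suc r) ab≤m

      bridge₁ : A (X (a + s)) (Y r)
      bridge₁ = Forward⇒F (a + s) r g₁
      bridge₂ : A (Y r) (X (suc a + s))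
      bridge₂ = backward-arc (suc a + s) r ¬g₂
      bridge₃ : A (X (b + (suc a + s))) (Y (suc r))
      bridge₃ = Forward⇒F (b + (suc a + s)) (suc r) (subst Forward regroup₃ g₃)
        where
          regroup₃ : suc (suc b) + (a + s + r) ≡ b + (suc a + s) + suc r
          regroup₃ = solve (a ∷ b ∷ s ∷ r ∷ [])

      Xs₂∩Ys₂≡∅ : Disjoint A Xs₂ Ys₂
      Xs₂∩Ys₂≡∅ = X-Y-disjoint (suc a + s) (suc r) b<n ab≤m
      Inner : SimplePath A (suc b + suc (a + b))
      Inner = append A Xs₂ Ys₂ Xs₂∩Ys₂≡∅ bridge₃
      Ys₁∩Inner≡∅ : Disjoint A Ys₁ Inner
      Ys₁∩Inner≡∅ = disjoint-append A Ys₁ Xs₂ Ys₂ Xs₂∩Ys₂≡∅ bridge₃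
        (Y-X-disjoint r (suc a + s) 1<m b<n) (Y-windows-disjoint r 1<m ab≤m ab<m)
      Rest : SimplePath A (1 + (suc b + suc (a + b)))
      Rest = append A Ys₁ Inner Ys₁∩Inner≡∅ bridge₂
      Xs₁∩Rest≡∅ : Disjoint A Xs₁ Rest
      Xs₁∩Rest≡∅ = disjoint-append A Xs₁ Ys₁ Inner Ys₁∩Inner≡∅ bridge₂
        (X-Y-disjoint s r a<n 1<m)
        (disjoint-append A Xs₁ Xs₂ Ys₂ Xs₂∩Ys₂≡∅ bridge₃
          (X-windows-disjoint s a<n b<n ab<n) (X-Y-disjoint s (suc r) a<n ab≤m))
      C : SimplePath A (suc a + (1 + (suc b + suc (a + b))))
      C = append A Xs₁ Rest Xs₁∩Rest≡∅ bridge₁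

      1≤t : 1 ≤ a + suc (suc b + suc (a + b))
      1≤t = ≤-trans (s≤s z≤n) (m≤n+m _ a)
      last : vertex C (a + suc (suc b + suc (a + b))) ≡ Y (a + b + suc r)
      last = begin
        vertex C (a + suc (suc b + suc (a + b)))
          ≡⟨ cong (vertex C) (+-suc a (suc b + suc (a + b))) ⟩
        vertex C (suc a + (suc b + suc (a + b)))
          ≡⟨ append-right A Xs₁ Rest Xs₁∩Rest≡∅ bridge₁ (suc b + suc (a + b)) ⟩
        vertex Rest (suc b + suc (a + b))
          ≡⟨ append-right A Ys₁ Inner Ys₁∩Inner≡∅ bridge₂ (b + suc (a + b)) ⟩
        vertex Inner (b + suc (a + b))
          ≡⟨ cong (vertex Inner) (+-suc b (a + b)) ⟩
        vertex Inner (suc b + (a + b))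
          ≡⟨ append-right A Xs₂ Ys₂ Xs₂∩Ys₂≡∅ bridge₃ (a + b) ⟩
        Y (a + b + suc r)
          ∎
        where open ≡-Reasoning
      regroup₄ : suc b + (a + s + r) ≡ s + (a + b + suc r)
      regroup₄ = solve (a ∷ b ∷ s ∷ r ∷ [])
      closing : A (vertex C (a + suc (suc b + suc (a + b)))) (X s)
      closing = subst (λ v → A v (X s)) (sym last)
        (backward-arc s (a + b + suc r) (¬g₄ ∘ subst Forward (sym regroup₄)))

  module _ (j : ℕ) (g : Forward j) (¬g : ¬ Forward (suc j)) where

    odd-cycles : ∀ k → 1 ≤ k → k ≤ n → suc k ≤ m → ∀ v → CycleThrough A (suc (k + k)) v
    odd-cycles (suc a) _ a<n a<m = subst (λ t → ∀ v → CycleThrough A t v) (+-suc (suc a) (suc a))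
      (through-everywhere _ a j λ s r T≡j →
        two-block a 1 s r a<n a<m (Forward-resp j (a + s + r) (sym T≡j) g)
          (¬g ∘ Forward-resp (1 + (a + s + r)) (1 + j) (+-congˡ-mod (a + s + r) j 1 T≡j)))

    short-gap-cycles : ∀ a b → suc a + suc b ≤ n → suc (suc (a + b)) ≤ m →
      (∀ i → i ≤ b → ¬ Forward (suc i + j)) → Forward (suc (suc b) + j) →
      ∀ v → CycleThrough A (suc a + (1 + (suc b + suc (a + b)))) v
    short-gap-cycles a b ab<n ab<m gap rise = through-everywhere _ a j λ s r T≡j →
      let T = a + s + r in
      four-block a b s r ab<n ab<m (Forward-resp j T (sym T≡j) g)
        (¬g ∘ Forward-resp (1 + T) (1 + j) (+-congˡ-mod T j 1 T≡j))
        (Forward-resp (suc (suc b) + j) (suc (suc b) + T) (sym (+-congˡ-mod T j (suc (suc b)) T≡j)) rise)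
        (gap b ≤-refl ∘ Forward-resp (suc b + T) (suc b + j) (+-congˡ-mod T j (suc b) T≡j))

    long-gap-cycles : ∀ a → suc a ≤ n → suc (2 + a) ≤ m → ¬ Forward (2 + j) →
      ∀ v → CycleThrough A (suc a + suc (2 + a)) v
    long-gap-cycles a a<n a<m ¬g₂ = through-everywhere _ a j λ s r T≡j →
      two-block a 2 s r a<n a<m (Forward-resp j (a + s + r) (sym T≡j) g)
        (¬g₂ ∘ Forward-resp (2 + (a + s + r)) (2 + j) (+-congˡ-mod (a + s + r) j 2 T≡j))

    j≡m+j : j % m ≡ (m + j) % m
    j≡m+j = trans (sym ([m+n]%n≡m%n j m)) (cong (_% m) (+-comm j m))

    even-cycles : ∀ k → 2 ≤ k → k ≤ n → k ≤ m → ∀ v → CycleThrough A (k + k) v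
    even-cycles k 2≤k k≤n k≤m
      with first-exit (λ i → ¬ Forward (suc i + j)) (λ i → ¬? (Forward? (suc i + j))) m′ ¬g
             (λ ¬g′ → ¬g′ (Forward-resp j (m + j) j≡m+j g))
    ... | i , i<m′ , gap , rise with suc (suc i) ≤? k
    ...   | yes short with m≤n⇒∃[o]m+o≡n short
    ...     | a , refl = subst (λ t → ∀ v → CycleThrough A t v) length
      (short-gap-cycles a i (subst (_≤ n) X-count k≤n) (subst (_≤ m) Y-count k≤m) gap
        (decidable-stable (Forward? (suc (suc i) + j)) rise))
      where
        X-count : suc (suc i) + a ≡ suc a + suc i
        X-count = solve (a ∷ i ∷ [])
        Y-count : suc (suc i) + a ≡ suc (suc (a + i))
        Y-count = solve (a ∷ i ∷ [])
        length : suc a + (1 + (suc i + suc (a + i))) ≡ suc (suc i) + a + (suc (suc i) + a)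
        length = solve (a ∷ i ∷ [])
    even-cycles k 2≤k k≤n k≤m | i , i<m′ , gap , rise | no long with m≤n⇒∃[o]m+o≡n 2≤k
    ...     | a , refl = subst (λ t → ∀ v → CycleThrough A t v) (+-suc (suc a) (suc (suc a)))
      (long-gap-cycles a (≤-trans (n≤1+n (suc a)) k≤n) (s≤s (≤-trans k≤1+i i<m′))
        (gap 1 (≤-pred (≤-trans 2≤k k≤1+i))))
      where
        k≤1+i : 2 + a ≤ suc i
        k≤1+i = ≮⇒≥ long

  cycles-through-every-vertex : Strong A → ∀ v t → 3 ≤ t → t ≤ 2 * (n ⊓ m) → CycleThrough A t v
  cycles-through-every-vertex strong v t 3≤t t≤2M with switch strong | even-or-odd t
  ... | j , g , ¬g | k , inj₁ refl =
    even-cycles j g ¬g k (2≤k k 3≤t) (≤-trans k≤M (m⊓n≤m n m)) (≤-trans k≤M (m⊓n≤n n m)) v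
    where
      k≤M : k ≤ n ⊓ m
      k≤M = half-≤ k (n ⊓ m) t≤2M
      2≤k : ∀ k → 3 ≤ k + k → 2 ≤ k
      2≤k (suc (suc _)) _ = s≤s (s≤s z≤n)
      2≤k (suc zero) (s≤s (s≤s ()))
  ... | j , g , ¬g | k , inj₂ refl =
    odd-cycles j g ¬g k (1≤k k 3≤t) (≤-trans (<⇒≤ k<M) (m⊓n≤m n m)) (≤-trans k<M (m⊓n≤n n m)) v
    where
      k<M : k < n ⊓ m
      k<M = half-< k (n ⊓ m) t≤2M
      1≤k : ∀ k → 3 ≤ suc (k + k) → 1 ≤ k
      1≤k zero (s≤s ())
      1≤k (suc _) _ = s≤s z≤n

proposition2 : ∀ (n m : ℕ) (A : Arcs (Fin n ⊎ Fin m)) (x : Fin n → Fin n) (y : Fin m → Fin m) →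
    Loopless A → GenSum A → HamCycle (D₁ A) x → HamCycle (D₂ A) y →
    Strong A → ¬ GoodPair A x y →
    ∀ (v : Fin n ⊎ Fin m) (t : ℕ) → 3 ≤ t → t ≤ 2 * (n ⊓ m) → CycleThrough A t v
proposition2 zero _ _ _ _ _ _ (() , _) _ _ _
proposition2 (suc _) zero _ _ _ _ _ _ (() , _) _ _
proposition2 (suc n′) (suc m′) A x y _ one-arc x-cycle y-cycle strong no-good-pair =
  WithoutGoodPair.cycles-through-every-vertex n′ m′ A x y one-arc x-cycle y-cycle no-good-pair strong
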